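{- Let $\mathbf{ILX}$ be a logic extending $\mathbf{IL}$ and $T$ an $\mathbf{ILX}$-theory with $T\nvdash_{\mathbf{ILX}}\Box\bot$. Then there are $\mathbf{ILX}$-MCSs $\Gamma,\Delta$ with $\Gamma\prec_T\Delta$.
   Context: Formulas: $\bot$, propositional variables, $\to$, $\Box$, binary $\rhd$; $\Diamond A:=\neg\Box\neg A$. $\mathbf{IL}$: classical tautologies, K, L: $\Box(\Box A\to A)\to\Box A$, J1: $\Box(A\to B)\to A\rhd B$, J2: $(A\rhd B)\wedge(B\rhd C)\to A\rhd C$, J3: $(A\rhd C)\wedge(B\rhd C)\to A\vee B\rhd C$, J4: $A\rhd B\to(\Diamond A\to\Diamond B)$, J5: $\Diamond A\rhd A$; rules modus ponens and necessitation. An $\mathbf{ILX}$-theory is a set of formulas containing $\mathbf{ILX}$ closed under modus ponens and necessitation; an $\mathbf{ILX}$-MCS is a maximal $\mathbf{ILX}$-consistent set. $\Gamma\prec_T\Delta$ iff for every formula $A$ and finite $T'\subseteq T$, $\neg A\rhd\bigvee_{\sigma\in T'}\neg\sigma\in\Gamma$ implies $A,\Box A\in\Delta$ (empty disjunction is $\bot$). -}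

module Defs where

open import Data.Nat using (ℕ)
open import Data.Bool using (Bool; true; false; not; _∧_; _∨_)
open import Data.List using (List; []; _∷_; map)
open import Data.List.Relation.Unary.All using (All)
open import Data.Product using (_×_)
open import Relation.Binary.PropositionalEquality using (_≡_)
open import Relation.Nullary using (¬_)

infixr 5 _⇒_
infix 6 _▷_

data Fm : Set where
  ⊥'  : Fm
  var : ℕ → Fm
  _⇒_ : Fm → Fm → Fm
  □   : Fm → Fm
  _▷_ : Fm → Fm → Fm

~ : Fm → Fm
~ A = A ⇒ ⊥'

_∨'_ : Fm → Fm → Fm
A ∨' B = ~ A ⇒ B

_∧'_ : Fm → Fm → Fm
A ∧' B = ~ (A ⇒ ~ B)

◇ : Fm → Fm
◇ A = ~ (□ (~ A))

-- Classical tautologies: valid under every Boolean valuation that treats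
-- variables, □-formulas and ▷-formulas as atoms.
eval : (Fm → Bool) → Fm → Bool
eval v ⊥'        = false
eval v (var p)   = v (var p)
eval v (A ⇒ B)   = not (eval v A) ∨ eval v B
eval v (□ A)     = v (□ A)
eval v (A ▷ B)   = v (A ▷ B)

Tautology : Fm → Set
Tautology A = (v : Fm → Bool) → eval v A ≡ true

data ILAxiom : Fm → Set where
  taut : ∀ {A} → Tautology A → ILAxiom A
  axK  : ∀ A B → ILAxiom (□ (A ⇒ B) ⇒ (□ A ⇒ □ B))
  axL  : ∀ A → ILAxiom (□ (□ A ⇒ A) ⇒ □ A)
  axJ1 : ∀ A B → ILAxiom (□ (A ⇒ B) ⇒ (A ▷ B))
  axJ2 : ∀ A B C → ILAxiom (((A ▷ B) ∧' (B ▷ C)) ⇒ (A ▷ C))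
  axJ3 : ∀ A B C → ILAxiom (((A ▷ C) ∧' (B ▷ C)) ⇒ ((A ∨' B) ▷ C))
  axJ4 : ∀ A B → ILAxiom ((A ▷ B) ⇒ (◇ A ⇒ ◇ B))
  axJ5 : ∀ A → ILAxiom (◇ A ▷ A)

FmSet : Set₁
FmSet = Fm → Set

_⊆_ : FmSet → FmSet → Set
S ⊆ S' = ∀ {A} → S A → S' A

record IsLogicExtendingIL (X : FmSet) : Set where
  field
    containsIL : ILAxiom ⊆ X
    closedMP   : ∀ {A B} → X (A ⇒ B) → X A → X B
    closedNec  : ∀ {A} → X A → X (□ A)

record IsTheory (X T : FmSet) : Set where
  field
    containsX : X ⊆ T
    closedMP  : ∀ {A B} → T (A ⇒ B) → T A → T B
    closedNec : ∀ {A} → T A → T (□ A)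

data _⊢[_]_ (S : FmSet) (X : FmSet) : Fm → Set where
  thm : ∀ {A} → X A → S ⊢[ X ] A
  hyp : ∀ {A} → S A → S ⊢[ X ] A
  mp  : ∀ {A B} → S ⊢[ X ] (A ⇒ B) → S ⊢[ X ] A → S ⊢[ X ] B

Consistent : FmSet → FmSet → Set
Consistent X S = ¬ (S ⊢[ X ] ⊥')

MCS : FmSet → FmSet → Set₁
MCS X Γ = Consistent X Γ × ((Γ' : FmSet) → Γ ⊆ Γ' → Consistent X Γ' → Γ' ⊆ Γ)

⋁ : List Fm → Fm
⋁ []       = ⊥'
⋁ (A ∷ As) = A ∨' ⋁ As

_≺[_]_ : FmSet → FmSet → FmSet → Set
Γ ≺[ T ] Δ = (A : Fm) (T' : List Fm) → All T T' →
             Γ (~ A ▷ ⋁ (map ~ T')) → Δ A × Δ (□ A)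

module Submission where

-- Extend T ∪ {¬□⊥} to an MCS Γ (Lindenbaum), and extend
-- {□⊥} ∪ {A | □A ∈ Γ} to an MCS Δ.  The second set is consistent by Löb's
-- axiom: otherwise Γ ⊢ □(□⊥ → ⊥), hence Γ ⊢ □⊥.  If ¬A ▷ ⋁¬T' ∈ Γ with
-- T' ⊆ T, then □¬⋁¬T' ∈ T ⊆ Γ, so J1 and J2 give ¬A ▷ ⊥, and J4 turns this
-- into □A ∈ Γ; thus A ∈ Δ, and □A ∈ Δ follows from □⊥ ∈ Δ.

open import Defs
open import Level using (0ℓ)
open import Axiom.ExcludedMiddle using (ExcludedMiddle)
open import Data.Product using (Σ; _×_; _,_)
open import Relation.Nullary using (¬_; yes; no)
open import Data.Nat using (ℕ; zero; suc; _≤_; _≤′_; ≤′-refl; ≤′-step; _⊔_)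
open import Data.Nat.Properties using (≤⇒≤′; m≤m⊔n; m≤n⊔m)
open import Data.Bool using (true; false)
open import Data.Sum using (_⊎_; inj₁; inj₂)
open import Data.Empty using (⊥-elim)
open import Data.List using (List; []; _∷_; map; _++_; cartesianProductWith)
open import Data.List.Relation.Unary.All using (All; []; _∷_)
open import Data.List.Relation.Unary.Any using (here; there)
open import Data.List.Membership.Propositional using (_∈_)
open import Data.List.Membership.Propositional.Properties
  using (∈-map⁺; ∈-++⁺ˡ; ∈-++⁺ʳ; ∈-cartesianProductWith⁺)
open import Relation.Binary.PropositionalEquality using (_≡_; refl)

tK : ∀ A B → Tautology (A ⇒ (B ⇒ A))
tK A B v with eval v A | eval v B
... | true  | true  = refl
... | true  | false = refl
... | false | true  = refl
... | false | false = refl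

tS : ∀ A B C → Tautology ((A ⇒ (B ⇒ C)) ⇒ ((A ⇒ B) ⇒ (A ⇒ C)))
tS A B C v with eval v A | eval v B | eval v C
... | true  | true  | true  = refl
... | true  | true  | false = refl
... | true  | false | true  = refl
... | true  | false | false = refl
... | false | true  | true  = refl
... | false | true  | false = refl
... | false | false | true  = refl
... | false | false | false = refl

tI : ∀ A → Tautology (A ⇒ A)
tI A v with eval v A
... | true  = refl
... | false = refl

tDN : ∀ A → Tautology (~ (~ A) ⇒ A)
tDN A v with eval v A
... | true  = refl
... | false = refl

tEFQ : ∀ A → Tautology (⊥' ⇒ A)
tEFQ A v = refl

infixl 5 _,,_
_,,_ : FmSet → Fm → FmSet
(S ,, B) A = S A ⊎ A ≡ B

⋃ : (ℕ → FmSet) → FmSet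
⋃ C A = Σ ℕ λ n → C n A

Increasing : (ℕ → FmSet) → Set
Increasing C = ∀ {n} → C n ⊆ C (suc n)

chain-mono : (C : ℕ → FmSet) → Increasing C → ∀ {m n} → m ≤ n → C m ⊆ C n
chain-mono C step m≤n = go (≤⇒≤′ m≤n)
  where
  go : ∀ {m n} → m ≤′ n → C m ⊆ C n
  go ≤′-refl       c = c
  go (≤′-step m≤n) c = step (go m≤n c)

chain-common : (C : ℕ → FmSet) → Increasing C → ∀ {A B} →
               ⋃ C A → ⋃ C B → Σ ℕ λ k → C k A × C k B
chain-common C step (m , a) (n , b) =
  m ⊔ n , chain-mono C step (m≤m⊔n m n) a , chain-mono C step (m≤n⊔m m n) b

compose : List Fm → List Fm
compose L = map □ L ++ cartesianProductWith _⇒_ L L ++ cartesianProductWith _▷_ L L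

stratum : ℕ → List Fm
stratum zero    = ⊥' ∷ []
stratum (suc n) = var n ∷ stratum n ++ compose (stratum n)

Stratum : ℕ → FmSet
Stratum n A = A ∈ stratum n

stratum-increasing : Increasing Stratum
stratum-increasing p = there (∈-++⁺ˡ p)

composed-in-next : ∀ {n A} → A ∈ compose (stratum n) → A ∈ stratum (suc n)
composed-in-next {n} p = there (∈-++⁺ʳ (stratum n) p)

□∈compose : ∀ {L A} → A ∈ L → □ A ∈ compose L
□∈compose p = ∈-++⁺ˡ (∈-map⁺ □ p)

⇒∈compose : ∀ {L A B} → A ∈ L → B ∈ L → (A ⇒ B) ∈ compose L
⇒∈compose {L} p q = ∈-++⁺ʳ (map □ L) (∈-++⁺ˡ (∈-cartesianProductWith⁺ _⇒_ p q))

▷∈compose : ∀ {L A B} → A ∈ L → B ∈ L → (A ▷ B) ∈ compose L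
▷∈compose {L} p q =
  ∈-++⁺ʳ (map □ L) (∈-++⁺ʳ (cartesianProductWith _⇒_ L L) (∈-cartesianProductWith⁺ _▷_ p q))

stratum-exhaustive : ∀ A → ⋃ Stratum A
stratum-exhaustive ⊥'      = zero , here refl
stratum-exhaustive (var k) = suc k , here refl
stratum-exhaustive (□ A) with stratum-exhaustive A
... | n , p = suc n , composed-in-next (□∈compose p)
stratum-exhaustive (A ⇒ B)
  with chain-common Stratum stratum-increasing (stratum-exhaustive A) (stratum-exhaustive B)
... | n , p , q = suc n , composed-in-next (⇒∈compose p q)
stratum-exhaustive (A ▷ B)
  with chain-common Stratum stratum-increasing (stratum-exhaustive A) (stratum-exhaustive B)
... | n , p , q = suc n , composed-in-next (▷∈compose p q)

weaken : ∀ {X S S' A} → S ⊆ S' → S ⊢[ X ] A → S' ⊢[ X ] A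
weaken f (thm x)  = thm x
weaken f (hyp s)  = hyp (f s)
weaken f (mp d e) = mp (weaken f d) (weaken f e)

-- A derivation is finite, so one from a chain's union uses a single stage.
chain-compact : ∀ {X A} (C : ℕ → FmSet) → Increasing C →
                ⋃ C ⊢[ X ] A → Σ ℕ λ n → C n ⊢[ X ] A
chain-compact C step (thm x)      = zero , thm x
chain-compact C step (hyp (n , c)) = n , hyp c
chain-compact C step (mp d e)
  with chain-common (λ n A → C n ⊢[ _ ] A) (weaken step)
         (chain-compact C step d) (chain-compact C step e)
... | n , d' , e' = n , mp d' e'

theory-closed : ∀ {X T A} → IsTheory X T → T ⊢[ X ] A → T A
theory-closed T-theory (thm x)  = IsTheory.containsX T-theory x
theory-closed T-theory (hyp t)  = t
theory-closed T-theory (mp d e) =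
  IsTheory.closedMP T-theory (theory-closed T-theory d) (theory-closed T-theory e)

module Lindenbaum (em : ExcludedMiddle 0ℓ) (X : FmSet)
                  (list : ℕ → List Fm) (exhaustive : ∀ A → Σ ℕ λ n → A ∈ list n) where

  add : FmSet → Fm → FmSet
  add S A B = S B ⊎ (Consistent X (S ,, A) × B ≡ A)

  addAll : List Fm → FmSet → FmSet
  addAll []       S = S
  addAll (A ∷ As) S = addAll As (add S A)

  addAll-extends : ∀ As {S} → S ⊆ addAll As S
  addAll-extends []       s = s
  addAll-extends (A ∷ As) s = addAll-extends As (inj₁ s)

  add-consistent : ∀ {S} A → Consistent X S → Consistent X (add S A)
  add-consistent {S} A S-con d with em {Consistent X (S ,, A)}
  ... | yes SA-con = SA-con (weaken into-SA d)
    where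
    into-SA : add S A ⊆ (S ,, A)
    into-SA (inj₁ s)       = inj₁ s
    into-SA (inj₂ (_ , e)) = inj₂ e
  ... | no SA-incon = S-con (weaken into-S d)
    where
    into-S : add S A ⊆ S
    into-S (inj₁ s)            = s
    into-S (inj₂ (SA-con , _)) = ⊥-elim (SA-incon SA-con)

  addAll-consistent : ∀ As {S} → Consistent X S → Consistent X (addAll As S)
  addAll-consistent []       c = c
  addAll-consistent (A ∷ As) c = addAll-consistent As (add-consistent A c)

  addAll-saturated : ∀ As {S A} → A ∈ As → Consistent X (addAll As S ,, A) → addAll As S A
  addAll-saturated (B ∷ Bs) {S} (here refl) c =
    addAll-extends Bs (inj₂ ((λ d → c (weaken later d)) , refl))
    where
    later : (S ,, B) ⊆ (addAll Bs (add S B) ,, B)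
    later (inj₁ s) = inj₁ (addAll-extends Bs (inj₁ s))
    later (inj₂ e) = inj₂ e
  addAll-saturated (B ∷ Bs) (there p) c = addAll-saturated Bs p c

  module Extension (S : FmSet) (S-con : Consistent X S) where
    stage : ℕ → FmSet
    stage zero    = S
    stage (suc n) = addAll (list n) (stage n)

    stage-increasing : Increasing stage
    stage-increasing {n} = addAll-extends (list n)

    stage-consistent : ∀ n → Consistent X (stage n)
    stage-consistent zero    = S-con
    stage-consistent (suc n) = addAll-consistent (list n) (stage-consistent n)

    limit-consistent : Consistent X (⋃ stage)
    limit-consistent d with chain-compact stage stage-increasing d
    ... | n , d' = stage-consistent n d'

    limit-maximal : (Γ' : FmSet) → ⋃ stage ⊆ Γ' → Consistent X Γ' → Γ' ⊆ ⋃ stage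
    limit-maximal Γ' sub Γ'-con {A} A∈Γ' with exhaustive A
    ... | k , p = suc k , addAll-saturated (list k) p (λ d → Γ'-con (weaken into-Γ' d))
      where
      into-Γ' : (stage (suc k) ,, A) ⊆ Γ'
      into-Γ' (inj₁ s)    = sub (suc k , s)
      into-Γ' (inj₂ refl) = A∈Γ'

  lindenbaum : (S : FmSet) → Consistent X S → Σ FmSet λ Γ → MCS X Γ × S ⊆ Γ
  lindenbaum S S-con = ⋃ stage , (limit-consistent , limit-maximal) , (λ s → zero , s)
    where open Extension S S-con

module Reasoning (X : FmSet) (LX : IsLogicExtendingIL X) where
  open IsLogicExtendingIL LX

  infix 3 _⊢_
  _⊢_ : FmSet → Fm → Set
  S ⊢ A = S ⊢[ X ] A

  axiom : ∀ {S A} → ILAxiom A → S ⊢ A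
  axiom a = thm (containsIL a)

  tautology : ∀ {S A} → Tautology A → S ⊢ A
  tautology t = axiom (taut t)

  □-tautology : ∀ {S A} → Tautology A → S ⊢ □ A
  □-tautology t = thm (closedNec (containsIL (taut t)))

  assumption : ∀ {S A} → S ,, A ⊢ A
  assumption = hyp (inj₂ refl)

  lift : ∀ {S A B} → S ⊢ A → S ,, B ⊢ A
  lift = weaken inj₁

  deduction : ∀ {S A B} → S ,, B ⊢ A → S ⊢ B ⇒ A
  deduction {A = A} {B} (thm x)        = mp (tautology (tK A B)) (thm x)
  deduction {A = A} {B} (hyp (inj₁ s)) = mp (tautology (tK A B)) (hyp s)
  deduction {B = B} (hyp (inj₂ refl))  = tautology (tI B)
  deduction {B = B} (mp {C} {D} d e)   = mp (mp (tautology (tS B C D)) (deduction d)) (deduction e)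

  by-contradiction : ∀ {S A} → S ,, ~ A ⊢ ⊥' → S ⊢ A
  by-contradiction {A = A} d = mp (tautology (tDN A)) (deduction d)

  ¬¬-intro : ∀ {S A} → S ⊢ A → S ⊢ ~ (~ A)
  ¬¬-intro d = deduction (mp assumption (lift d))

  ∧-intro : ∀ {S A B} → S ⊢ A → S ⊢ B → S ⊢ A ∧' B
  ∧-intro d e = deduction (mp (mp assumption (lift d)) (lift e))

  ¬⇒-intro : ∀ {S A B} → S ⊢ A → S ⊢ ~ B → S ⊢ ~ (A ⇒ B)
  ¬⇒-intro d e = deduction (mp (lift e) (mp assumption (lift d)))

  refutes-⋁ : ∀ {S Ts} → All S Ts → S ⊢ ~ (⋁ (map ~ Ts))
  refutes-⋁ []       = tautology (tI ⊥')
  refutes-⋁ (σ ∷ σs) = ¬⇒-intro (¬¬-intro (hyp σ)) (refutes-⋁ σs)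

  mcs-closed : ∀ {Γ A} → MCS X Γ → Γ ⊢ A → Γ A
  mcs-closed {Γ} {A} (Γ-con , Γ-max) d =
    Γ-max (Γ ,, A) inj₁ (λ e → Γ-con (mp (deduction e) d)) (inj₂ refl)

  □-mp : ∀ {S A B} → S ⊢ □ (A ⇒ B) → S ⊢ □ A → S ⊢ □ B
  □-mp d e = mp (mp (axiom (axK _ _)) d) e

  □-¬¬-elim : ∀ {S A} → S ⊢ □ (~ (~ A)) → S ⊢ □ A
  □-¬¬-elim {A = A} = □-mp (□-tautology (tDN A))

  □⊥-explosion : ∀ {S A} → S ⊢ □ ⊥' → S ⊢ □ A
  □⊥-explosion {A = A} = □-mp (□-tautology (tEFQ A))

  boxed : FmSet → FmSet
  boxed Γ A = Γ (□ A)

  box-lift : ∀ {Γ A} → boxed Γ ⊢ A → Γ ⊢ □ A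
  box-lift (thm x)  = thm (closedNec x)
  box-lift (hyp g)  = hyp g
  box-lift (mp d e) = □-mp (box-lift d) (box-lift e)

  löb-successor-consistent : ∀ {Γ} → ¬ (Γ ⊢ □ ⊥') → Consistent X (boxed Γ ,, □ ⊥')
  löb-successor-consistent Γ⊬□⊥ d = Γ⊬□⊥ (mp (axiom (axL ⊥')) (box-lift (deduction d)))

  ▷-trans : ∀ {S A B C} → S ⊢ A ▷ B → S ⊢ B ▷ C → S ⊢ A ▷ C
  ▷-trans d e = mp (axiom (axJ2 _ _ _)) (∧-intro d e)

  -- J4: what interprets ⊥ is impossible.
  ▷⊥-□¬ : ∀ {S A} → S ⊢ A ▷ ⊥' → S ⊢ □ (~ A)
  ▷⊥-□¬ d = by-contradiction
    (mp (mp (mp (axiom (axJ4 _ ⊥')) (lift d)) assumption) (□-tautology (tI ⊥')))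

  ▷-refutation : ∀ {S A B} → S ⊢ ~ A ▷ B → S ⊢ □ (~ B) → S ⊢ □ A
  ▷-refutation d e = □-¬¬-elim (▷⊥-□¬ (▷-trans d (mp (axiom (axJ1 _ ⊥')) e)))

  ≺-criterion : ∀ {T Γ Δ} → IsTheory X T → MCS X Γ → MCS X Δ →
                T ⊆ Γ → boxed Γ ⊆ Δ → Δ (□ ⊥') → Γ ≺[ T ] Δ
  ≺-criterion {T} {Γ} T-theory Γ-mcs Δ-mcs T⊆Γ Γ□⊆Δ □⊥∈Δ A T' T'⊆T ¬A▷⋁ =
    Γ□⊆Δ □A∈Γ , mcs-closed Δ-mcs (□⊥-explosion (hyp □⊥∈Δ))
    where
    □¬⋁∈T : T (□ (~ (⋁ (map ~ T'))))
    □¬⋁∈T = IsTheory.closedNec T-theory (theory-closed T-theory (refutes-⋁ T'⊆T))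
    □A∈Γ : Γ (□ A)
    □A∈Γ = mcs-closed Γ-mcs (▷-refutation (hyp ¬A▷⋁) (hyp (T⊆Γ □¬⋁∈T)))

lemma5p5 : ExcludedMiddle 0ℓ →
    (X : FmSet) → IsLogicExtendingIL X →
    (T : FmSet) → IsTheory X T →
    ¬ (T ⊢[ X ] □ ⊥') →
    Σ FmSet λ Γ → Σ FmSet λ Δ → MCS X Γ × MCS X Δ × (Γ ≺[ T ] Δ)
lemma5p5 em X LX T T-theory T⊬□⊥ =
  let open Reasoning X LX
      open Lindenbaum em X stratum stratum-exhaustive
      (Γ , Γ-mcs@(Γ-con , _) , T¬□⊥⊆Γ) =
        lindenbaum (T ,, ~ (□ ⊥')) (λ d → T⊬□⊥ (by-contradiction d))
      Γ⊬□⊥ : ¬ (Γ ⊢ □ ⊥')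
      Γ⊬□⊥ = λ d → Γ-con (mp (hyp (T¬□⊥⊆Γ (inj₂ refl))) d)
      (Δ , Δ-mcs , Δ-ext) = lindenbaum (boxed Γ ,, □ ⊥') (löb-successor-consistent Γ⊬□⊥)
  in Γ , Δ , Γ-mcs , Δ-mcs ,
     ≺-criterion T-theory Γ-mcs Δ-mcs (λ t → T¬□⊥⊆Γ (inj₁ t))
                 (λ g → Δ-ext (inj₁ g)) (Δ-ext (inj₂ refl))
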